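{- Quasisymmetric Schur $Q$-functions do not expand positively into Young quasisymmetric Schur functions: there exists a peak composition $\alpha$ such that the expansion of $\widehat Q_\alpha$ in the basis $\{\widehat s_\beta\}$ of quasisymmetric functions has a negative coefficient.
   Context: A composition is a sequence of positive integers; $\ell(\alpha)$ is its number of parts. A peak composition is a composition in which no part except possibly the last equals $1$; diagrams are in English notation with left-justified rows, row $i$ from the top having $\alpha_i$ boxes. $M_\beta(X)=\sum_{i_1<\cdots<i_m}x_{i_1}^{\beta_1}\cdots x_{i_m}^{\beta_m}$. A peak composition tableau of shape $\alpha$: filling with positive integers, rows weakly increasing left to right, first column strictly increasing top to bottom, and for every $k$ the row lengths (top to bottom, omitting empty rows) of the cells with entries $\le k$ form a peak composition; $\mathrm{wt}(T)_i$ = number of entries $i$; $PCT(\alpha)$ = those with no value skipped. For $T\in PCT(\alpha)$, $p(T)=\sum_i(\#\text{distinct entries in row } i-1)$, $m(T)$ = number of first-column boxes whose box immediately below and box immediately to the right contain the same number. $\widehat P_\alpha=\sum_{T\in PCT(\alpha)}2^{p(T)-m(T)}M_{\mathrm{wt}(T)}$ and $\widehat Q_\alpha=2^{\ell(\alpha)}\widehat P_\alpha$. A semistandard Young composition tableau of shape $\beta$ (a composition) is a filling of its diagram with positive integers such that rows weakly increase left to right, the first column strictly increases top to bottom, and whenever a cell $C_1$ with entry $c_1$ and a cell $C_2$ with entry $c_2$ are such that $C_2$ lies in a lower row and in the column immediately to the left of the column of $C_1$, and $c_1\ge c_2$, there is a cell $C_3$ in the row of $C_2$ and column of $C_1$ whose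 entry $c_3$ satisfies $c_1>c_3$. The Young quasisymmetric Schur function is $\widehat s_\beta=\sum_T\prod_{\text{cells}}x_{\text{entry}}$, summed over all such tableaux $T$ of shape $\beta$; these form a basis of quasisymmetric functions. -}

module Defs where

open import Data.Bool using (Bool; true; false; _∧_; _∨_; not; if_then_else_)
open import Data.Nat using (ℕ; zero; suc; _+_; _*_; _∸_; _^_; _≡ᵇ_; _<ᵇ_)
open import Data.List using (List; []; _∷_; length; map; concatMap; filter; upTo; foldr)
open import Data.Nat.ListAction using (sum)
open import Data.Bool.ListAction using (and)
open import Data.Product using (_×_)
open import Data.List.Relation.Unary.All using (All)
open import Data.Maybe using (Maybe; just; nothing)
open import Data.Integer using (ℤ; +_) renaming (_+_ to _+ℤ_; _*_ to _*ℤ_)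
open import Relation.Binary.PropositionalEquality using (_≡_)
open import Relation.Nullary.Decidable using (T?)
open import Data.Bool using (T)

IsComposition : List ℕ → Set
IsComposition α = All (λ a → 1 Data.Nat.≤ a) α

size : List ℕ → ℕ
size = sum

noInnerOne : List ℕ → Bool
noInnerOne []           = true
noInnerOne (a ∷ [])     = true
noInnerOne (a ∷ b ∷ as) = not (a ≡ᵇ 1) ∧ noInnerOne (b ∷ as)

IsPeakComposition : List ℕ → Set
IsPeakComposition α = IsComposition α × (noInnerOne α ≡ true)

-- The list of all compositions of n (each exactly once).  A composition of
-- n+1 arises uniquely from one of n by prepending a part 1 or increasing
-- the first part by one.
incFirst : List ℕ → List (List ℕ)
incFirst []       = []
incFirst (a ∷ as) = (suc a ∷ as) ∷ []

comps : ℕ → List (List ℕ)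
comps zero    = [] ∷ []
comps (suc n) = concatMap (λ c → (1 ∷ c) ∷ incFirst c) (comps n)

-- A filling is given row by row (row i from the top is the i-th list).
Filling : Set
Filling = List (List ℕ)

range1 : ℕ → List ℕ
range1 N = map suc (upTo N)

wordsOf : ℕ → ℕ → List (List ℕ)
wordsOf N zero    = [] ∷ []
wordsOf N (suc r) = concatMap (λ x → map (x ∷_) (wordsOf N r)) (range1 N)

fillings : ℕ → List ℕ → List Filling
fillings N []       = [] ∷ []
fillings N (a ∷ α)  = concatMap (λ w → map (w ∷_) (fillings N α)) (wordsOf N a)

weaklyIncr : List ℕ → Bool
weaklyIncr []           = true
weaklyIncr (a ∷ [])     = true
weaklyIncr (a ∷ b ∷ as) = not (b <ᵇ a) ∧ weaklyIncr (b ∷ as)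

rowsWeak : Filling → Bool
rowsWeak T = and (map weaklyIncr T)

firstEntries : Filling → List ℕ
firstEntries []             = []
firstEntries ([] ∷ T)       = firstEntries T   -- not reached for compositions
firstEntries ((x ∷ _) ∷ T)  = x ∷ firstEntries T

strictIncr : List ℕ → Bool
strictIncr []           = true
strictIncr (a ∷ [])     = true
strictIncr (a ∷ b ∷ as) = (a <ᵇ b) ∧ strictIncr (b ∷ as)

firstColStrict : Filling → Bool
firstColStrict T = strictIncr (firstEntries T)

countEntry : ℕ → Filling → ℕ
countEntry i T = sum (map (λ r → length (filter (λ x → T? (x ≡ᵇ i)) r)) T)

weightUpTo : ℕ → Filling → List ℕ
weightUpTo N T = map (λ i → countEntry i T) (range1 N)

listEqᵇ : List ℕ → List ℕ → Bool
listEqᵇ []       []       = true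
listEqᵇ (a ∷ as) (b ∷ bs) = (a ≡ᵇ b) ∧ listEqᵇ as bs
listEqᵇ _        _        = false

hasWeight : List ℕ → Filling → Bool
hasWeight γ T = listEqᵇ (weightUpTo (length γ) T) γ

restrictShape : ℕ → Filling → List ℕ
restrictShape k T = filter (λ c → T? (not (c ≡ᵇ 0))) (map (λ r → length (filter (λ x → T? (not (k <ᵇ x))) r)) T)

-- for every k the restricted shape is a peak composition.  For a filling
-- with entries in {1..N} it suffices to test k = 0..N (k = 0 gives the
-- empty composition, k ≥ N gives the full shape).
peakCondition : ℕ → Filling → Bool
peakCondition N T = and (map (λ k → noInnerOne (restrictShape k T)) (range1 N))

-- PCT(α) with weight γ: γ a composition, so "no value skipped" is automatic.
isPCTofWeight : List ℕ → Filling → Bool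
isPCTofWeight γ T = rowsWeak T ∧ firstColStrict T ∧ peakCondition (length γ) T ∧ hasWeight γ T

distinct : List ℕ → ℕ
distinct []           = 0
distinct (a ∷ [])     = 1
distinct (a ∷ b ∷ as) = (if a ≡ᵇ b then 0 else 1) + distinct (b ∷ as)   -- rows are weakly increasing

pStat : Filling → ℕ
pStat T = sum (map (λ r → distinct r ∸ 1) T)

mStat : Filling → ℕ
mStat []                          = 0
mStat (r ∷ [])                    = 0
mStat ((x ∷ y ∷ r) ∷ (z ∷ s) ∷ T) = (if y ≡ᵇ z then 1 else 0) + mStat ((z ∷ s) ∷ T)
mStat (r ∷ s ∷ T)                 = mStat (s ∷ T)

-- coefficient of M_γ in P̂_α:  Σ_{T ∈ PCT(α), wt(T) = γ} 2^{p(T) − m(T)}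
-- (p(T) ≥ m(T) always holds, so truncated subtraction is exact)
coeffPhat : List ℕ → List ℕ → ℕ
coeffPhat α γ =
  sum (map (λ T → 2 ^ (pStat T ∸ mStat T))
           (filter (λ T → T? (isPCTofWeight γ T)) (fillings (length γ) α)))

coeffQhat : List ℕ → List ℕ → ℕ
coeffQhat α γ = 2 ^ length α * coeffPhat α γ

-- entry of T in row i, column j (0-indexed), if that cell exists
entry : Filling → ℕ → ℕ → Maybe ℕ
entry []       i       j       = nothing
entry (r ∷ T)  (suc i) j       = entry T i j
entry (r ∷ T)  zero    j       = go r j
  where
  go : List ℕ → ℕ → Maybe ℕ
  go []       _       = nothing
  go (x ∷ xs) zero    = just x
  go (x ∷ xs) (suc j) = go xs j

rowLen : Filling → ℕ → ℕ
rowLen []      _       = 0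
rowLen (r ∷ T) zero    = length r
rowLen (r ∷ T) (suc i) = rowLen T i

-- triple condition for C₁ = (r₁, j+1), C₂ = (r₂, j), r₁ < r₂:
-- if c₁ ≥ c₂ then the cell C₃ = (r₂, j+1) exists and c₁ > c₃.
tripleAt : Filling → ℕ → ℕ → ℕ → Bool
tripleAt T r₁ r₂ j with entry T r₁ (suc j) | entry T r₂ j
... | just c₁ | just c₂ =
      if c₁ <ᵇ c₂ then true
      else (case₃ (entry T r₂ (suc j)))
  where
  case₃ : Maybe ℕ → Bool
  case₃ (just c₃) = c₃ <ᵇ c₁
  case₃ nothing   = false
... | _ | _ = true

idx : ℕ → List ℕ
idx = upTo

tripleCondition : Filling → Bool
tripleCondition T =
  and (map (λ r₁ → and (map (λ r₂ →
        if r₁ <ᵇ r₂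
        then and (map (λ j → tripleAt T r₁ r₂ j) (idx (rowLen T r₁)))
        else true) (idx (length T)))) (idx (length T)))

isSSYCTofWeight : List ℕ → Filling → Bool
isSSYCTofWeight γ T = rowsWeak T ∧ firstColStrict T ∧ tripleCondition T ∧ hasWeight γ T

-- coefficient of x_1^{γ_1} ⋯ x_k^{γ_k} (= coefficient of M_γ, by
-- quasisymmetry) in ŝ_β: number of SSYCT of shape β with weight γ
coeffS : List ℕ → List ℕ → ℕ
coeffS β γ = length (filter (λ T → T? (isSSYCTofWeight γ T)) (fillings (length γ) β))

sumℤ : List ℤ → ℤ
sumℤ = foldr _+ℤ_ (+ 0)

-- Q̂_α = Σ_{β ⊨ |α|} c_β ŝ_β, as an identity of quasisymmetric functions,
-- i.e. equality of the coefficients of every M_γ.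
IsExpansion : List ℕ → (List ℕ → ℤ) → Set
IsExpansion α c =
  (γ : List ℕ) → IsComposition γ →
  + coeffQhat α γ ≡ sumℤ (map (λ β → c β *ℤ + coeffS β γ) (comps (size α)))

-- For α = (2,2,1) a direct computation gives
--   Q̂_{221} = 8 ŝ_{221} + 8 ŝ_{131} + 8 ŝ_{212} − 8 ŝ_{1211}.
-- The expansion is unique: in a suitable ordering of the compositions of 5 the
-- matrix of coefficients of the monomials M_γ in the ŝ_β is unitriangular.
-- Only degree 5 has to be inspected, because the multiset of entries of a
-- filling of shape α has exactly |α| elements, so every coefficient of M_γ
-- with |γ| ≠ |α| vanishes on both sides.
module Submission where

open import Defs
open import Data.Nat using (ℕ)
open import Data.List using (List)
open import Data.List.Membership.Propositional using (_∈_)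
open import Data.Integer using (ℤ; _<_; +_)
open import Data.Product using (Σ; ∃; _×_)

open import Algebra.Bundles using (CommutativeMonoid)
open import Data.Bool using (Bool; true; false; T; if_then_else_; _∧_)
open import Data.Bool.Properties using (T-∧)
open import Data.Empty using (⊥-elim)
open import Data.Integer using (-[1+_]; -<+) renaming (_+_ to _+ℤ_; _*_ to _*ℤ_; _≟_ to _≟ℤ_)
import Data.Integer.Properties as ℤ
open import Data.List using ([]; _∷_; _++_; [_]; map; filter; length; upTo)
open import Data.List.Membership.Propositional.Properties using (∈-concat⁺′; ∈-map⁺)
open import Data.List.Properties using (map-++; map-cong; map-cong-local; upTo-∷ʳ; filter-none)
open import Data.List.Relation.Binary.Permutation.Propositional using (_↭_; ↭-sym; ↭-trans; ↭⇒↭ₛ)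
open import Data.List.Relation.Binary.Permutation.Propositional.Properties
  using (All-resp-↭) renaming (map⁺ to ↭-map⁺)
import Data.List.Relation.Binary.Permutation.Setoid.Properties as ↭ₛ
import Data.List.Relation.Binary.Lex.NonStrict as Lex
open import Data.List.Relation.Unary.All as All using (All; []; _∷_; all?)
open import Data.List.Relation.Unary.All.Properties using (concat⁺; ++⁺) renaming (map⁺ to All-map⁺)
open import Data.List.Relation.Unary.Any using (here; there)
open import Data.Nat using (zero; suc; _+_; _*_; _^_; _≤_; _≡ᵇ_; z≤n; s≤s; _≟_)
  renaming (_<_ to _<ℕ_)
import Data.Nat.Properties as ℕ
open import Data.Nat.ListAction using (sum)
open import Data.Nat.ListAction.Properties using (sum-++)
open import Data.Product using (_,_)
open import Data.Unit using (⊤; tt)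
open import Function using (_∘_; Equivalence)
open import Relation.Binary.Bundles using (DecTotalOrder)
open import Relation.Binary.PropositionalEquality
  using (_≡_; _≢_; refl; sym; trans; cong; cong₂; subst; module ≡-Reasoning)
open import Relation.Nullary using (Dec; yes; no)
open import Relation.Nullary.Decidable using (T?; from-yes; _×-dec_)

open import Algebra.Properties.AbelianGroup ℤ.+-0-abelianGroup using (∙-cancelʳ)
open import Algebra.Properties.CommutativeSemigroup ℕ.+-commutativeSemigroup using (interchange)

module _ {a ℓ₁ ℓ₂} (O : DecTotalOrder a ℓ₁ ℓ₂) where
  open import Data.List.Sort.InsertionSort O using (sort)
  open import Data.List.Sort.InsertionSort.Properties O using (sort-↭)

  ↭-by-sort : ∀ {xs ys} → sort xs ≡ sort ys → xs ↭ ys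
  ↭-by-sort {xs} {ys} eq = ↭-trans (↭-sym (sort-↭ xs)) (subst (_↭ ys) (sym eq) (sort-↭ ys))

sumℤ-↭ : ∀ {xs ys} → xs ↭ ys → sumℤ xs ≡ sumℤ ys
sumℤ-↭ p = ↭ₛ.foldr-commMonoid ℤ+.setoid ℤ+.isCommutativeMonoid (↭⇒↭ₛ p)
  where module ℤ+ = CommutativeMonoid ℤ.+-0-commutativeMonoid

module Combination {A : Set} (S : A → A → ℕ) where

  combination : (A → ℤ) → List A → A → ℤ
  combination c L γ = sumℤ (map (λ β → c β *ℤ + S β γ) L)

  UnitUpperTriangular : List A → Set
  UnitUpperTriangular []      = ⊤
  UnitUpperTriangular (β ∷ L) = S β β ≡ 1 × All (λ γ → S β γ ≡ 0) L × UnitUpperTriangular L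

  unitUpperTriangular? : ∀ L → Dec (UnitUpperTriangular L)
  unitUpperTriangular? []      = yes tt
  unitUpperTriangular? (β ∷ L) =
    (S β β ≟ 1) ×-dec (all? (λ γ → S β γ ≟ 0) L ×-dec unitUpperTriangular? L)

  combination-↭ : ∀ {c L L′} γ → L ↭ L′ → combination c L γ ≡ combination c L′ γ
  combination-↭ γ p = sumℤ-↭ (↭-map⁺ _ p)

  combination-cong : ∀ {c c′ L} γ → All (λ β → c β ≡ c′ β) L →
                     combination c L γ ≡ combination c′ L γ
  combination-cong γ eqs = cong sumℤ (map-cong-local (All.map (cong (_*ℤ + S _ γ)) eqs))

  combination-∷-zero : ∀ {c β L γ} → S β γ ≡ 0 → combination c (β ∷ L) γ ≡ combination c L γ
  combination-∷-zero {c} {β} {L} {γ} Sβγ≡0 = begin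
    c β *ℤ + S β γ +ℤ combination c L γ  ≡⟨ cong (λ s → c β *ℤ + s +ℤ combination c L γ) Sβγ≡0 ⟩
    c β *ℤ + 0 +ℤ combination c L γ      ≡⟨ cong (_+ℤ combination c L γ) (ℤ.*-zeroʳ (c β)) ⟩
    + 0 +ℤ combination c L γ             ≡⟨ ℤ.+-identityˡ _ ⟩
    combination c L γ                     ∎
    where open ≡-Reasoning

  combination-zero : ∀ {c L γ} → All (λ β → S β γ ≡ 0) L → combination c L γ ≡ + 0
  combination-zero                   []               = refl
  combination-zero {c} {β ∷ L} {γ} (Sβγ≡0 ∷ zeros) =
    trans (combination-∷-zero {c} {β} {L} Sβγ≡0) (combination-zero {c} {L} zeros)

  -- The head β of L has no term in the equations of the later γ, so the tail is
  -- solved first; the equation of β then isolates c β.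
  combination-injective : ∀ {c c′} L → UnitUpperTriangular L →
    All (λ γ → combination c L γ ≡ combination c′ L γ) L → All (λ β → c β ≡ c′ β) L
  combination-injective []      _                          []            = []
  combination-injective {c} {c′} (β ∷ L) (Sββ≡1 , row , triangular) (eqβ ∷ eqs) =
    cβ≡c′β ∷ agree
    where
    agree : All (λ β′ → c β′ ≡ c′ β′) L
    agree = combination-injective {c} {c′} L triangular
      (All.zipWith (λ (Sβγ≡0 , eq) →
         trans (sym (combination-∷-zero {c} {β} {L} Sβγ≡0))
               (trans eq (combination-∷-zero {c′} {β} {L} Sβγ≡0)))
       (row , eqs))

    diagonal : ∀ (d : A → ℤ) → d β *ℤ + S β β ≡ d β
    diagonal d = trans (cong (λ s → d β *ℤ + s) Sββ≡1) (ℤ.*-identityʳ (d β))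

    cβ≡c′β : c β ≡ c′ β
    cβ≡c′β = ∙-cancelʳ (combination c′ L β) (c β) (c′ β) (begin
      c β +ℤ combination c′ L β                ≡⟨ cong₂ _+ℤ_ (diagonal c) (combination-cong β agree) ⟨
      c β *ℤ + S β β +ℤ combination c L β      ≡⟨ eqβ ⟩
      c′ β *ℤ + S β β +ℤ combination c′ L β    ≡⟨ cong (_+ℤ combination c′ L β) (diagonal c′) ⟩
      c′ β +ℤ combination c′ L β               ∎)
      where open ≡-Reasoning

open Combination coeffS

δ : ℕ → ℕ → ℕ
δ x i = if x ≡ᵇ i then 1 else 0

δ-refl : ∀ x → δ x x ≡ 1
δ-refl zero    = refl
δ-refl (suc x) = δ-refl x

δ-≢ : ∀ {x i} → x ≢ i → δ x i ≡ 0
δ-≢ {zero}  {zero}  x≢i = ⊥-elim (x≢i refl)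
δ-≢ {zero}  {suc i} _   = refl
δ-≢ {suc x} {zero}  _   = refl
δ-≢ {suc x} {suc i} x≢i = δ-≢ (λ x≡i → x≢i (cong suc x≡i))

occurrences : ℕ → List ℕ → ℕ
occurrences i w = length (filter (λ x → T? (x ≡ᵇ i)) w)

occurrences-∷ : ∀ i x w → occurrences i (x ∷ w) ≡ δ x i + occurrences i w
occurrences-∷ i x w with x ≡ᵇ i
... | true  = refl
... | false = refl

sum-map-+ : ∀ (f g : ℕ → ℕ) xs → sum (map (λ i → f i + g i) xs) ≡ sum (map f xs) + sum (map g xs)
sum-map-+ f g []       = refl
sum-map-+ f g (x ∷ xs) = trans (cong (λ s → f x + g x + s) (sum-map-+ f g xs)) (interchange (f x) (g x) _ _)

sum-map-zero : ∀ (xs : List ℕ) → sum (map (λ _ → 0) xs) ≡ 0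
sum-map-zero []       = refl
sum-map-zero (_ ∷ xs) = sum-map-zero xs

range1-∷ʳ : ∀ N → range1 (suc N) ≡ range1 N ++ [ suc N ]
range1-∷ʳ N = trans (cong (map suc) (sym (upTo-∷ʳ N))) (map-++ suc (upTo N) [ N ])

sum-range1-suc : ∀ (f : ℕ → ℕ) N → sum (map f (range1 (suc N))) ≡ sum (map f (range1 N)) + f (suc N)
sum-range1-suc f N = begin
  sum (map f (range1 (suc N)))                  ≡⟨ cong (λ xs → sum (map f xs)) (range1-∷ʳ N) ⟩
  sum (map f (range1 N ++ [ suc N ]))           ≡⟨ cong sum (map-++ f (range1 N) [ suc N ]) ⟩
  sum (map f (range1 N) ++ [ f (suc N) ])       ≡⟨ sum-++ (map f (range1 N)) [ f (suc N) ] ⟩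
  sum (map f (range1 N)) + (f (suc N) + 0)      ≡⟨ cong (λ s → sum (map f (range1 N)) + s) (ℕ.+-identityʳ _) ⟩
  sum (map f (range1 N)) + f (suc N)            ∎
  where open ≡-Reasoning

δ-sum-above : ∀ N {x} → N <ℕ x → sum (map (δ x) (range1 N)) ≡ 0
δ-sum-above zero    _   = refl
δ-sum-above (suc N) {x} N<x
  rewrite sum-range1-suc (δ x) N | δ-sum-above N (ℕ.<-trans (ℕ.n<1+n N) N<x) = δ-≢ (ℕ.>⇒≢ N<x)

δ-sum-range1 : ∀ N → All (λ x → x ≤ N × sum (map (δ x) (range1 N)) ≡ 1) (range1 N)
δ-sum-range1 zero    = []
δ-sum-range1 (suc N) = subst (All _) (sym (range1-∷ʳ N)) (++⁺ (All.map earlier (δ-sum-range1 N)) (last ∷ []))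
  where
  earlier : ∀ {x} → x ≤ N × sum (map (δ x) (range1 N)) ≡ 1 →
            x ≤ suc N × sum (map (δ x) (range1 (suc N))) ≡ 1
  earlier {x} (x≤N , sum≡1) rewrite sum-range1-suc (δ x) N | sum≡1 | δ-≢ (ℕ.<⇒≢ (s≤s x≤N)) =
    ℕ.m≤n⇒m≤1+n x≤N , refl
  last : suc N ≤ suc N × sum (map (δ (suc N)) (range1 (suc N))) ≡ 1
  last rewrite sum-range1-suc (δ (suc N)) N | δ-sum-above N (ℕ.n<1+n N) | δ-refl N = ℕ.≤-refl , refl

totalWeight : ℕ → List ℕ → ℕ
totalWeight N w = sum (map (λ i → occurrences i w) (range1 N))

wordsOf-totalWeight : ∀ N a → All (λ w → totalWeight N w ≡ a) (wordsOf N a)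
wordsOf-totalWeight N zero    = sum-map-zero (range1 N) ∷ []
wordsOf-totalWeight N (suc a) =
  concat⁺ (All-map⁺ (All.map (λ {x} (_ , δ-sum≡1) →
    All-map⁺ (All.map (λ {w} → prepend {x} {w} δ-sum≡1) (wordsOf-totalWeight N a))) (δ-sum-range1 N)))
  where
  prepend : ∀ {x w} → sum (map (δ x) (range1 N)) ≡ 1 → totalWeight N w ≡ a →
            totalWeight N (x ∷ w) ≡ suc a
  prepend {x} {w} δ-sum≡1 w-weight = begin
    totalWeight N (x ∷ w)
      ≡⟨ cong sum (map-cong (λ i → occurrences-∷ i x w) (range1 N)) ⟩
    sum (map (λ i → δ x i + occurrences i w) (range1 N))
      ≡⟨ sum-map-+ (δ x) (λ i → occurrences i w) (range1 N) ⟩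
    sum (map (δ x) (range1 N)) + totalWeight N w
      ≡⟨ cong₂ _+_ δ-sum≡1 w-weight ⟩
    suc a
      ∎
    where open ≡-Reasoning

fillings-weight : ∀ N α → All (λ F → sum (weightUpTo N F) ≡ size α) (fillings N α)
fillings-weight N []      = sum-map-zero (range1 N) ∷ []
fillings-weight N (a ∷ α) =
  concat⁺ (All-map⁺ (All.map (λ {w} w-weight →
    All-map⁺ (All.map (λ {F} F-weight → prepend {w} {F} w-weight F-weight) (fillings-weight N α)))
  (wordsOf-totalWeight N a)))
  where
  prepend : ∀ {w F} → totalWeight N w ≡ a → sum (weightUpTo N F) ≡ size α →
            sum (weightUpTo N (w ∷ F)) ≡ a + size α
  prepend {w} {F} w-weight F-weight =
    trans (sum-map-+ (λ i → occurrences i w) (λ i → countEntry i F) (range1 N)) (cong₂ _+_ w-weight F-weight)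

listEqᵇ⇒≡ : ∀ xs ys → T (listEqᵇ xs ys) → xs ≡ ys
listEqᵇ⇒≡ []       []       _ = refl
listEqᵇ⇒≡ (x ∷ xs) (y ∷ ys) h =
  let x≡y , xs≡ys = Equivalence.to T-∧ h in cong₂ _∷_ (ℕ.≡ᵇ⇒≡ x y x≡y) (listEqᵇ⇒≡ xs ys xs≡ys)

T-∧ʳ : ∀ {x y} → T (x ∧ y) → T y
T-∧ʳ {true} t = t

filter-weight-off-degree : ∀ {γ α} (p : Filling → Bool) → (∀ F → T (p F) → T (hasWeight γ F)) →
  size γ ≢ size α → filter (λ F → T? (p F)) (fillings (length γ) α) ≡ []
filter-weight-off-degree {γ} {α} p p⇒weight |γ|≢|α| = filter-none (λ F → T? (p F))
  (All.map (λ {F} F-weight pF → |γ|≢|α| (trans (|γ|≡ F (p⇒weight F pF)) F-weight))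
           (fillings-weight (length γ) α))
  where
  |γ|≡ : ∀ F → T (hasWeight γ F) → size γ ≡ sum (weightUpTo (length γ) F)
  |γ|≡ F h = cong sum (sym (listEqᵇ⇒≡ (weightUpTo (length γ) F) γ h))

isPCTofWeight⇒hasWeight : ∀ γ F → T (isPCTofWeight γ F) → T (hasWeight γ F)
isPCTofWeight⇒hasWeight γ F = T-∧ʳ {peakCondition (length γ) F} ∘ T-∧ʳ {firstColStrict F} ∘ T-∧ʳ {rowsWeak F}

isSSYCTofWeight⇒hasWeight : ∀ γ F → T (isSSYCTofWeight γ F) → T (hasWeight γ F)
isSSYCTofWeight⇒hasWeight γ F = T-∧ʳ {tripleCondition F} ∘ T-∧ʳ {firstColStrict F} ∘ T-∧ʳ {rowsWeak F}

coeffPhat-off-degree : ∀ {α γ} → size γ ≢ size α → coeffPhat α γ ≡ 0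
coeffPhat-off-degree {α} {γ} neq
  rewrite filter-weight-off-degree {γ} {α} (isPCTofWeight γ) (isPCTofWeight⇒hasWeight γ) neq = refl

coeffS-off-degree : ∀ {β γ} → size γ ≢ size β → coeffS β γ ≡ 0
coeffS-off-degree {β} {γ} neq
  rewrite filter-weight-off-degree {γ} {β} (isSSYCTofWeight γ) (isSSYCTofWeight⇒hasWeight γ) neq = refl

comps-sound : ∀ n → All (λ β → IsComposition β × size β ≡ n) (comps n)
comps-sound zero    = ([] , refl) ∷ []
comps-sound (suc n) = concat⁺ (All-map⁺ (All.map extend (comps-sound n)))
  where
  extend : ∀ {β} → IsComposition β × size β ≡ n →
           All (λ β′ → IsComposition β′ × size β′ ≡ suc n) ((1 ∷ β) ∷ incFirst β)
  extend {[]}    (β-comp , refl)            = (s≤s z≤n ∷ β-comp , refl) ∷ []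
  extend {b ∷ β} (1≤b ∷ β-comp , refl) =
    (s≤s z≤n ∷ 1≤b ∷ β-comp , refl) ∷ (s≤s z≤n ∷ β-comp , refl) ∷ []

comps-complete : ∀ γ → IsComposition γ → γ ∈ comps (size γ)
comps-complete []      []                = here refl
comps-complete (a ∷ γ) (1≤a ∷ γ-comp) = prepend a 1≤a
  where
  prepend : ∀ a → 1 ≤ a → (a ∷ γ) ∈ comps (a + size γ)
  prepend 1             _ = ∈-concat⁺′ (here refl) (∈-map⁺ _ (comps-complete γ γ-comp))
  prepend (suc (suc a)) _ = ∈-concat⁺′ (there (here refl)) (∈-map⁺ _ (prepend (suc a) (s≤s z≤n)))

expansion-in-degree : ∀ {α c} →
  All (λ γ → + coeffQhat α γ ≡ combination c (comps (size α)) γ) (comps (size α)) → IsExpansion α c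
expansion-in-degree {α} {c} eqs γ γ-comp with size γ ≟ size α
... | yes |γ|≡|α| = All.lookup eqs (subst (λ n → γ ∈ comps n) |γ|≡|α| (comps-complete γ γ-comp))
... | no  |γ|≢|α| = begin
  + (2 ^ length α * coeffPhat α γ)    ≡⟨ cong (λ k → + (2 ^ length α * k))
                                              (coeffPhat-off-degree {α} {γ} |γ|≢|α|) ⟩
  + (2 ^ length α * 0)                ≡⟨ cong +_ (ℕ.*-zeroʳ (2 ^ length α)) ⟩
  + 0                                 ≡⟨ combination-zero {c} {comps (size α)} {γ} column-zero ⟨
  combination c (comps (size α)) γ    ∎
  where
  open ≡-Reasoning
  column-zero : All (λ β → coeffS β γ ≡ 0) (comps (size α))
  column-zero = All.map (λ {β} (_ , |β|≡|α|) →
                           coeffS-off-degree {β} {γ} (λ |γ|≡|β| → |γ|≢|α| (trans |γ|≡|β| |β|≡|α|)))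
                        (comps-sound (size α))

expansion-unique : ∀ {α c c′ L} → L ↭ comps (size α) → UnitUpperTriangular L →
  IsExpansion α c → IsExpansion α c′ → All (λ β → c β ≡ c′ β) L
expansion-unique {α} {c} {c′} {L} L↭ triangular c-exp c′-exp =
  combination-injective L triangular
    (All.map (λ (γ-comp , _) → agree γ-comp) (All-resp-↭ (↭-sym L↭) (comps-sound (size α))))
  where
  open ≡-Reasoning
  agree : ∀ {γ} → IsComposition γ → combination c L γ ≡ combination c′ L γ
  agree {γ} γ-comp = begin
    combination c L γ                    ≡⟨ combination-↭ {c} γ L↭ ⟩
    combination c (comps (size α)) γ     ≡⟨ c-exp γ γ-comp ⟨
    + coeffQhat α γ                      ≡⟨ c′-exp γ γ-comp ⟩
    combination c′ (comps (size α)) γ    ≡⟨ combination-↭ {c′} γ (↭-sym L↭) ⟩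
    combination c′ L γ                   ∎

α₀ : List ℕ
α₀ = 2 ∷ 2 ∷ 1 ∷ []

c₀ : List ℕ → ℤ
c₀ (2 ∷ 2 ∷ 1 ∷ [])     = + 8
c₀ (1 ∷ 3 ∷ 1 ∷ [])     = + 8
c₀ (2 ∷ 1 ∷ 2 ∷ [])     = + 8
c₀ (1 ∷ 2 ∷ 1 ∷ 1 ∷ []) = -[1+ 7 ]
c₀ _                    = + 0

c₀-expansion : IsExpansion α₀ c₀
c₀-expansion = expansion-in-degree {α₀} {c₀}
  (from-yes (all? (λ γ → + coeffQhat α₀ γ ≟ℤ combination c₀ (comps 5) γ) (comps 5)))

-- comps 5 with (3,1,1), (1,3,1) and (4,1) moved behind the γ whose M_γ occur in their ŝ
triangularOrder : List (List ℕ)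
triangularOrder =
  (1 ∷ 1 ∷ 1 ∷ 1 ∷ 1 ∷ []) ∷ (2 ∷ 1 ∷ 1 ∷ 1 ∷ []) ∷ (1 ∷ 2 ∷ 1 ∷ 1 ∷ []) ∷ (1 ∷ 1 ∷ 2 ∷ 1 ∷ []) ∷
  (2 ∷ 2 ∷ 1 ∷ []) ∷ (1 ∷ 1 ∷ 1 ∷ 2 ∷ []) ∷ (2 ∷ 1 ∷ 2 ∷ []) ∷ (3 ∷ 1 ∷ 1 ∷ []) ∷
  (1 ∷ 2 ∷ 2 ∷ []) ∷ (1 ∷ 3 ∷ 1 ∷ []) ∷ (3 ∷ 2 ∷ []) ∷ (1 ∷ 1 ∷ 3 ∷ []) ∷
  (2 ∷ 3 ∷ []) ∷ (4 ∷ 1 ∷ []) ∷ (1 ∷ 4 ∷ []) ∷ (5 ∷ []) ∷ []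

triangularOrder-↭ : triangularOrder ↭ comps 5
triangularOrder-↭ = ↭-by-sort (Lex.≤-decTotalOrder ℕ.≤-decTotalOrder) refl

triangularOrder-unitUpperTriangular : UnitUpperTriangular triangularOrder
triangularOrder-unitUpperTriangular = from-yes (unitUpperTriangular? triangularOrder)

mainTheorem6 : ∃ λ (α : List ℕ) → IsPeakComposition α
                 × (Σ (List ℕ → ℤ) λ c → IsExpansion α c)
                 × ((c : List ℕ → ℤ) → IsExpansion α c →
                      ∃ λ (β : List ℕ) → β ∈ comps (size α) × c β < + 0)
mainTheorem6 = α₀ , (s≤s z≤n ∷ s≤s z≤n ∷ s≤s z≤n ∷ [] , refl) , (c₀ , c₀-expansion) , negative
  where
  negative : (c : List ℕ → ℤ) → IsExpansion α₀ c → ∃ λ β → β ∈ comps 5 × c β < + 0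
  negative c c-exp = 1 ∷ 2 ∷ 1 ∷ 1 ∷ [] , there (there (here refl)) , subst (_< + 0) -8≡c₁₂₁₁ -<+
    where
    -8≡c₁₂₁₁ : -[1+ 7 ] ≡ c (1 ∷ 2 ∷ 1 ∷ 1 ∷ [])
    -8≡c₁₂₁₁ = All.lookup (expansion-unique {α₀} {c₀} {c} triangularOrder-↭ triangularOrder-unitUpperTriangular
                                            c₀-expansion c-exp)
                          (there (there (here refl)))
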